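{- Let $\beta$ be a primitive $p^2$-th root of unity in an extension field of $\mathbb{F}_2$. If $a\in pD_k^{(p)}$, then for every integer $b$, \[H_b^{(p)}(\beta^a)=\tfrac{p-1}{2}\pmod 2,\qquad H_b^{(p^2)}(\beta^a)=\tfrac{p-1}{2}\pmod 2+H_{b+k}^{(p)}(\beta),\] where $\frac{p-1}{2}\pmod 2$ is regarded as an element of $\mathbb{F}_2$.
   Context: Let $p$ be an odd prime, $p-1=ef$ with $f=2^r$, $r\ge1$, and let $g$ be a primitive root modulo $p^2$. For $j\in\{1,2\}$ let $d_j=p^{j-1}f$, $D_0^{(p^j)}=\{g^{d_j t}\bmod p^j: 0\le t<e\}$, $D_i^{(p^j)}=\{g^ix\bmod p^j: x\in D_0^{(p^j)}\}$; subscripts of $D^{(p^j)}$ are taken modulo $d_j$. For $D\subseteq\mathbb{Z}_p$, $pD=\{px:x\in D\}\subseteq\mathbb{Z}_{p^2}$. For an integer $v$ set $H_v^{(p)}=\bigcup_{i=0}^{f/2-1}pD^{(p)}_{(i+v)\bmod f}\subseteq\mathbb{Z}_{p^2}$ and $H_v^{(p^2)}=\bigcup_{i=0}^{pf/2-1}D^{(p^2)}_{(i+v)\bmod pf}\subseteq\mathbb{Z}_{p^2}$. For a set $T\subseteq\mathbb{Z}_{p^2}$, $T(x)=\sum_{t\in T}x^t\in\mathbb{F}_2[x]$. -}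

module Defs where

open import Level using (Level)
open import Data.Bool using (Bool; true; false; if_then_else_; _∨_)
open import Data.Nat using (ℕ; zero; suc; _+_; _*_; _∸_; _^_; _≤_; _<_; _≡ᵇ_)
open import Data.Nat.DivMod using (_%_; _/_)
open import Data.Integer using (ℤ; _%ℕ_)
open import Data.Product using (Σ; _×_)
open import Relation.Nullary using (¬_)
open import Relation.Binary.PropositionalEquality using (_≡_; _≢_)
open import Algebra.Bundles using (CommutativeRing)

anyBelow : ℕ → (ℕ → Bool) → Bool
anyBelow zero    P = false
anyBelow (suc n) P = anyBelow n P ∨ P n

-- residue of an integer modulo n (n ≥ 1 in all uses; value 0 if n = 0)
_modℤ_ : ℤ → ℕ → ℕ
v modℤ zero  = 0
v modℤ suc n = v %ℕ suc n

_modℕ_ : ℕ → ℕ → ℕ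
x modℕ zero  = 0
x modℕ suc n = x % suc n

-- g is a primitive root modulo n, where φn = φ(n): the multiplicative order
-- of g modulo n is exactly φ(n).
IsPrimitiveRoot : (n φn g : ℕ) → Set
IsPrimitiveRoot n φn g =
  ((g ^ φn) modℕ n ≡ 1 modℕ n) ×
  (∀ m → 0 < m → m < φn → (g ^ m) modℕ n ≢ 1 modℕ n)

module Cyclotomy (p g e f : ℕ) where

  -- x ∈ D_i^{(p^j)}  where n = p^j and d = d_j = p^{j-1} f:
  -- x ≡ g^i · g^{d t} (mod n) for some 0 ≤ t < e   (i is already reduced mod d)
  memD : (n d i x : ℕ) → Bool
  memD n d i x = anyBelow e (λ t → ((g ^ (i + d * t)) modℕ n) ≡ᵇ (x modℕ n))

  memDp : ℕ → ℕ → Bool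
  memDp i x = memD p f (i modℕ f) x

  -- y ∈ p D_i^{(p)} ⊆ ℤ_{p²}: y = p x (mod p²) for some x ∈ D_i^{(p)} ⊆ ℤ_p
  memPDp : ℕ → ℕ → Bool
  memPDp i y = anyBelow p (λ x → memDp i x ∧' ((p * x) modℕ (p * p) ≡ᵇ y modℕ (p * p)))
    where
      _∧'_ : Bool → Bool → Bool
      true  ∧' b = b
      false ∧' _ = false

  memDp2 : ℕ → ℕ → Bool
  memDp2 i y = memD (p * p) (p * f) (i modℕ (p * f)) y

  memHp : ℤ → ℕ → Bool
  memHp v y = anyBelow (f / 2) (λ i → memPDp ((i + v modℤ f) modℕ f) y)

  memHp2 : ℤ → ℕ → Bool
  memHp2 v y = anyBelow ((p * f) / 2) (λ i → memDp2 ((i + v modℤ (p * f)) modℕ (p * f)) y)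

module Eval {c ℓ : Level} (R : CommutativeRing c ℓ) where
  open CommutativeRing R renaming (_+_ to _+ᴿ_; _*_ to _*ᴿ_)

  pow : Carrier → ℕ → Carrier
  pow x zero    = 1#
  pow x (suc n) = x *ᴿ pow x n

  sumBelow : ℕ → (ℕ → Carrier) → Carrier
  sumBelow zero    h = 0#
  sumBelow (suc n) h = sumBelow n h +ᴿ h n

  -- T(x) = Σ_{t ∈ T} x^t for T ⊆ ℤ_N given by its indicator
  evalSet : (N : ℕ) → (ℕ → Bool) → Carrier → Carrier
  evalSet N T x = sumBelow N (λ t → if T t then pow x t else 0#)

  parity : ℕ → Carrier
  parity n = if (n % 2) ≡ᵇ 0 then 0# else 1#

  IsField : Set (c Level.⊔ ℓ)
  IsField = (¬ (1# ≈ 0#)) × (∀ x → ¬ (x ≈ 0#) → Σ Carrier (λ y → x *ᴿ y ≈ 1#))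

  -- R has characteristic 2 (so it contains 𝔽₂ and, being a field, extends it)
  Char2 : Set ℓ
  Char2 = 1# +ᴿ 1# ≈ 0#

  IsPrimitiveRootOfUnity : ℕ → Carrier → Set ℓ
  IsPrimitiveRootOfUnity N β = (pow β N ≈ 1#) × (∀ m → 0 < m → m < N → ¬ (pow β m ≈ 1#))

-- Write a = p·x with x = g^K mod p and K ≡ k (mod f), and put γ = β^p, a primitive p-th root of
-- unity, so that β^a = γ^x.  Every element of H_b^(p) is a multiple of p, hence is sent to 1, and
-- H_b^(p) has (f/2)·e = (p-1)/2 elements.  An element g^j of H_b^(p²) is sent to γ^(g^(K+j) mod p),
-- so H_b^(p²)(β^a) is a sum of pf/2 = ((p-1)/2)·f + f/2 consecutive Gaussian periods
-- η_c = Σ_t γ^(g^(c+ft) mod p), which depend only on c mod f.  Each run of f consecutive periods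
-- is the sum of all nontrivial p-th roots of unity, that is 1 in characteristic 2, and the f/2
-- periods left over make up H_{b+k}^(p)(β).

module Submission where

open import Defs
open import Level using (Level)
open import Algebra.Bundles using (CommutativeRing)
open import Data.Bool using (Bool; true; false; if_then_else_; T)
open import Data.Bool.Properties using (T-≡)
open import Data.Nat using (ℕ; zero; suc; _+_; _*_; _∸_; _^_; _≤_; _<_; _/_; _%_; _≡ᵇ_; _<ᵇ_; NonZero; z<s; s≤s⁻¹)
import Data.Nat.Properties as ℕ
open import Data.Nat.Primality using (Prime)
open import Data.Integer using (ℤ; _%ℕ_)
open import Data.Product using (∃-syntax; ∃₂; _×_; _,_; proj₁; proj₂)
open import Data.Sum using (inj₁; inj₂)
open import Function.Bundles using (Equivalence)
open import Relation.Binary.PropositionalEquality as ≡ using (_≡_; _≢_)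
open import Relation.Nullary using (¬_; contradiction)

module Residues where

  open import Data.Nat using (>-nonZero; _≟_)
  open import Data.Nat.Properties
  open import Data.Nat.DivMod
  open import Data.Nat.Divisibility using (m∣m*n)
  open import Data.Nat.Tactic.RingSolver using (solve-∀)
  open import Data.Fin using (Fin; toℕ; fromℕ<; punchOut)
  open import Data.Fin.Properties using (toℕ-fromℕ<; toℕ-injective; toℕ<n; punchOut-injective; injective⇒≤; any?)
  open import Relation.Binary.PropositionalEquality
  open import Relation.Binary.Definitions using (tri<; tri≈; tri>)
  open import Relation.Nullary using (yes; no)
  open ≡-Reasoning

  module _ (n : ℕ) .{{_ : NonZero n}} where

    %-cong-+ : ∀ {x x′ y y′} → x % n ≡ x′ % n → y % n ≡ y′ % n → (x + y) % n ≡ (x′ + y′) % n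
    %-cong-+ {x} {x′} {y} {y′} x≡x′ y≡y′ = begin
      (x + y) % n               ≡⟨ %-distribˡ-+ x y n ⟩
      (x % n + y % n) % n       ≡⟨ cong₂ (λ u v → (u + v) % n) x≡x′ y≡y′ ⟩
      (x′ % n + y′ % n) % n     ≡⟨ %-distribˡ-+ x′ y′ n ⟨
      (x′ + y′) % n             ∎

    %-cong-* : ∀ {x x′ y y′} → x % n ≡ x′ % n → y % n ≡ y′ % n → (x * y) % n ≡ (x′ * y′) % n
    %-cong-* {x} {x′} {y} {y′} x≡x′ y≡y′ = begin
      (x * y) % n               ≡⟨ %-distribˡ-* x y n ⟩
      (x % n * (y % n)) % n     ≡⟨ cong₂ (λ u v → (u * v) % n) x≡x′ y≡y′ ⟩
      (x′ % n * (y′ % n)) % n   ≡⟨ %-distribˡ-* x′ y′ n ⟨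
      (x′ * y′) % n             ∎

    ^-%-cancelˡ : ∀ g N {m m′} → g ^ N % n ≡ 1 % n → m ≤ m′ → m′ ≤ N →
                  g ^ m % n ≡ g ^ m′ % n → g ^ (m′ ∸ m) % n ≡ 1 % n
    ^-%-cancelˡ g N {m} {m′} gᴺ≡1 m≤m′ m′≤N gᵐ≡gᵐ′ = begin
      g ^ δ % n                   ≡⟨ cong (_% n) (*-identityʳ (g ^ δ)) ⟨
      (g ^ δ * 1) % n             ≡⟨ %-cong-* {g ^ δ} refl gᵐ⁺ᶜ≡1 ⟨
      (g ^ δ * g ^ (m + c)) % n   ≡⟨ cong (_% n) (^-distribˡ-+-* g δ (m + c)) ⟨
      g ^ (δ + (m + c)) % n       ≡⟨ cong (λ u → g ^ u % n) (trans (rearrange δ m c) m+δ+c≡N) ⟩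
      g ^ N % n                   ≡⟨ gᴺ≡1 ⟩
      1 % n                       ∎
      where
      δ = m′ ∸ m
      c = N ∸ m′
      m+δ≡m′ : m + δ ≡ m′
      m+δ≡m′ = m+[n∸m]≡n m≤m′
      m+δ+c≡N : m + δ + c ≡ N
      m+δ+c≡N = trans (cong (_+ c) m+δ≡m′) (m+[n∸m]≡n m′≤N)
      rearrange : ∀ δ m c → δ + (m + c) ≡ m + δ + c
      rearrange = solve-∀
      gᵐ⁺ᶜ≡1 : g ^ (m + c) % n ≡ 1 % n
      gᵐ⁺ᶜ≡1 = begin
        g ^ (m + c) % n             ≡⟨ cong (_% n) (^-distribˡ-+-* g m c) ⟩
        (g ^ m * g ^ c) % n         ≡⟨ %-cong-* {y = g ^ c} gᵐ≡gᵐ′ refl ⟩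
        (g ^ m′ * g ^ c) % n        ≡⟨ cong (_% n) (^-distribˡ-+-* g m′ c) ⟨
        g ^ (m′ + c) % n            ≡⟨ cong (λ u → g ^ u % n) (m+[n∸m]≡n m′≤N) ⟩
        g ^ N % n                   ≡⟨ gᴺ≡1 ⟩
        1 % n                       ∎

    ^-%-injective : ∀ g N M → g ^ N % n ≡ 1 % n → M ≤ N →
                    (∀ δ → 0 < δ → δ < M → g ^ δ % n ≢ 1 % n) →
                    ∀ {m m′} → m < M → m′ < M → g ^ m % n ≡ g ^ m′ % n → m ≡ m′
    ^-%-injective g N M gᴺ≡1 M≤N order {m} {m′} m<M m′<M gᵐ≡gᵐ′ with <-cmp m m′
    ... | tri≈ _ m≡m′ _ = m≡m′
    ... | tri< m<m′ _ _ = contradiction (^-%-cancelˡ g N gᴺ≡1 (<⇒≤ m<m′) (≤-trans (<⇒≤ m′<M) M≤N) gᵐ≡gᵐ′)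
                                        (order _ (m<n⇒0<n∸m m<m′) (≤-<-trans (m∸n≤m m′ m) m′<M))
    ... | tri> _ _ m′<m = contradiction (^-%-cancelˡ g N gᴺ≡1 (<⇒≤ m′<m) (≤-trans (<⇒≤ m<M) M≤N) (sym gᵐ≡gᵐ′))
                                        (order _ (m<n⇒0<n∸m m′<m) (≤-<-trans (m∸n≤m m m′) m<M))

    +-%-cancelʳ : ∀ w {i i′} → (i + w) % n ≡ (i′ + w) % n → i % n ≡ i′ % n
    +-%-cancelʳ w {i} {i′} eq = begin
      i % n               ≡⟨ [i+w+u]%n≡i%n i ⟨
      (i + w + u) % n     ≡⟨ %-cong-+ {y = u} eq refl ⟩
      (i′ + w + u) % n    ≡⟨ [i+w+u]%n≡i%n i′ ⟩
      i′ % n              ∎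
      where
      u = n ∸ w % n
      rearrange : ∀ i r q u n → i + (r + q * n) + u ≡ i + (r + u) + q * n
      rearrange = solve-∀
      [i+w+u]%n≡i%n : ∀ i → (i + w + u) % n ≡ i % n
      [i+w+u]%n≡i%n i = begin
        (i + w + u) % n                   ≡⟨ cong (λ v → (i + v + u) % n) (m≡m%n+[m/n]*n w n) ⟩
        (i + (w % n + w / n * n) + u) % n ≡⟨ cong (_% n) (rearrange i (w % n) (w / n) u n) ⟩
        (i + (w % n + u) + w / n * n) % n ≡⟨ [m+kn]%n≡m%n (i + (w % n + u)) (w / n) n ⟩
        (i + (w % n + u)) % n             ≡⟨ cong (λ v → (i + v) % n) (m+[n∸m]≡n (m%n≤n w n)) ⟩
        (i + n) % n                       ≡⟨ [m+n]%n≡m%n i n ⟩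
        i % n                             ∎

    +-%-injectiveˡ : ∀ w {i i′} → i < n → i′ < n → (i + w) % n ≡ (i′ + w) % n → i ≡ i′
    +-%-injectiveˡ w {i} {i′} i<n i′<n eq =
      trans (sym (m<n⇒m%n≡m i<n)) (trans (+-%-cancelʳ w eq) (m<n⇒m%n≡m i′<n))

    divMod-unique : ∀ {c c′ t t′} → c < n → c′ < n → c + n * t ≡ c′ + n * t′ → c ≡ c′ × t ≡ t′
    divMod-unique {c} {c′} {t} {t′} c<n c′<n eq =
      c≡c′ , *-cancelˡ-≡ t t′ n (+-cancelˡ-≡ c _ _ (trans eq (cong (_+ n * t′) (sym c≡c′))))
      where
      [c+nt]%n≡c : ∀ {c} t → c < n → (c + n * t) % n ≡ c
      [c+nt]%n≡c {c} t c<n = trans (cong (λ u → (c + u) % n) (*-comm n t))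
                                   (trans ([m+kn]%n≡m%n c t n) (m<n⇒m%n≡m c<n))
      c≡c′ : c ≡ c′
      c≡c′ = trans (sym ([c+nt]%n≡c t c<n)) (trans (cong (_% n) eq) ([c+nt]%n≡c t′ c′<n))

  injective⇒onto : ∀ n (h : ℕ → ℕ) → (∀ {i} → i < n → h i < n) →
                   (∀ {i j} → i < n → j < n → h i ≡ h j → i ≡ j) →
                   ∀ {z} → z < n → ∃[ i ] i < n × h i ≡ z
  injective⇒onto (suc q) h bounded injective {z} z<n with any? (λ i → h (toℕ i) ≟ z)
  ... | yes (i , hi≡z) = toℕ i , toℕ<n i , hi≡z
  ... | no  missed     = contradiction (injective⇒≤ F-injective) 1+n≰n
    where
    hᶠ : Fin (suc q) → Fin (suc q)
    hᶠ i = fromℕ< (bounded (toℕ<n i))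

    toℕ-hᶠ : ∀ i → toℕ (hᶠ i) ≡ h (toℕ i)
    toℕ-hᶠ i = toℕ-fromℕ< (bounded (toℕ<n i))

    z≢hᶠ : ∀ i → fromℕ< z<n ≢ hᶠ i
    z≢hᶠ i eq = missed (i , trans (sym (toℕ-hᶠ i)) (trans (cong toℕ (sym eq)) (toℕ-fromℕ< z<n)))

    F : Fin (suc q) → Fin q
    F i = punchOut (z≢hᶠ i)

    F-injective : ∀ {i j} → F i ≡ F j → i ≡ j
    F-injective {i} {j} eq = toℕ-injective (injective (toℕ<n i) (toℕ<n j)
      (trans (sym (toℕ-hᶠ i)) (trans (cong toℕ (punchOut-injective (z≢hᶠ i) (z≢hᶠ j) eq)) (toℕ-hᶠ j))))

  [1+kp]^n-expansion : ∀ k p n → ∃[ s ] (1 + k * p) ^ n ≡ 1 + n * k * p + s * (p * p)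
  [1+kp]^n-expansion k p zero    = 0 , refl
  [1+kp]^n-expansion k p (suc n) with [1+kp]^n-expansion k p n
  ... | s , eq = n * k * k + s * (1 + k * p) , (begin
    (1 + k * p) * (1 + k * p) ^ n                   ≡⟨ cong ((1 + k * p) *_) eq ⟩
    (1 + k * p) * (1 + n * k * p + s * (p * p))     ≡⟨ expand k p n s ⟩
    1 + suc n * k * p + (n * k * k + s * (1 + k * p)) * (p * p) ∎)
    where
    expand : ∀ k p n s → (1 + k * p) * (1 + n * k * p + s * (p * p))
                         ≡ 1 + (1 + n) * k * p + (n * k * k + s * (1 + k * p)) * (p * p)
    expand = solve-∀

  c+d*t<d*e : ∀ {c d t e} → c < d → t < e → c + d * t < d * e
  c+d*t<d*e {c} {d} {t} c<d t<e =
    <-≤-trans (+-monoˡ-< (d * t) c<d) (≤-trans (≤-reflexive (sym (*-suc d t))) (*-monoʳ-≤ d t<e))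

  m*[2*n]/2≡m*n : ∀ m n → m * (2 * n) / 2 ≡ m * n
  m*[2*n]/2≡m*n m n = trans (cong (_/ 2) (regroup m n)) (m*n/n≡m (m * n) 2)
    where
    regroup : ∀ m n → m * (2 * n) ≡ m * n * 2
    regroup = solve-∀

  [1+m*[2*n]]*[2*n]/2≡m*n*[2*n]+n : ∀ m n → (1 + m * (2 * n)) * (2 * n) / 2 ≡ m * n * (2 * n) + n
  [1+m*[2*n]]*[2*n]/2≡m*n*[2*n]+n m n = trans (cong (_/ 2) (regroup m n)) (m*n/n≡m (m * n * (2 * n) + n) 2)
    where
    regroup : ∀ m n → (1 + m * (2 * n)) * (2 * n) ≡ (m * n * (2 * n) + n) * 2
    regroup = solve-∀

  modℕ≡% : ∀ x n .{{_ : NonZero n}} → x modℕ n ≡ x % n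
  modℕ≡% x (suc n) = refl

  module PrimitiveRootModSquare (p g : ℕ) (1<p : 1 < p) (prim : IsPrimitiveRoot (p * p) (p * (p ∸ 1)) g) where

    instance
      p≢0 : NonZero p
      p≢0 = >-nonZero (<-trans z<s 1<p)
      p²≢0 : NonZero (p * p)
      p²≢0 = m*n≢0 p p

    N : ℕ
    N = p * (p ∸ 1)

    p∸1≤N : p ∸ 1 ≤ N
    p∸1≤N = m≤n*m (p ∸ 1) p

    0%p≡0 : 0 % p ≡ 0
    0%p≡0 = m<n⇒m%n≡m (<-trans z<s 1<p)

    1%p≡1 : 1 % p ≡ 1
    1%p≡1 = m<n⇒m%n≡m 1<p

    gᴺ≡1-mod-p² : g ^ N % (p * p) ≡ 1 % (p * p)
    gᴺ≡1-mod-p² = trans (sym (modℕ≡% _ (p * p))) (trans (proj₁ prim) (modℕ≡% 1 (p * p)))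

    order-mod-p² : ∀ m → 0 < m → m < N → g ^ m % (p * p) ≢ 1 % (p * p)
    order-mod-p² m 0<m m<N eq = proj₂ prim m 0<m m<N (trans (modℕ≡% _ (p * p)) (trans eq (sym (modℕ≡% 1 (p * p)))))

    %p²%p : ∀ x → x % (p * p) % p ≡ x % p
    %p²%p x = m∣n⇒o%n%m≡o%m p (p * p) x (m∣m*n p)

    gᴺ≡1-mod-p : g ^ N % p ≡ 1 % p
    gᴺ≡1-mod-p = trans (sym (%p²%p (g ^ N))) (trans (cong (_% p) gᴺ≡1-mod-p²) (%p²%p 1))

    -- g^δ = 1 + kp implies g^(δp) ≡ 1 (mod p²), so the order of g modulo p cannot drop below p - 1.
    order-mod-p : ∀ δ → 0 < δ → δ < p ∸ 1 → g ^ δ % p ≢ 1 % p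
    order-mod-p δ 0<δ δ<p∸1 gᵟ≡1 = order-mod-p² (δ * p) (*-monoˡ-< p 0<δ) δp<N (begin
      g ^ (δ * p) % (p * p)                  ≡⟨ cong (_% (p * p)) (^-*-assoc g δ p) ⟨
      (g ^ δ) ^ p % (p * p)                  ≡⟨ cong (λ u → u ^ p % (p * p)) gᵟ≡1+kp ⟩
      (1 + k * p) ^ p % (p * p)              ≡⟨ cong (_% (p * p)) (proj₂ ([1+kp]^n-expansion k p p)) ⟩
      (1 + p * k * p + s * (p * p)) % (p * p) ≡⟨ cong (_% (p * p)) (collect k p s) ⟩
      (1 + (k + s) * (p * p)) % (p * p)      ≡⟨ [m+kn]%n≡m%n 1 (k + s) (p * p) ⟩
      1 % (p * p)                            ∎)
      where
      k = g ^ δ / p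
      s = proj₁ ([1+kp]^n-expansion k p p)
      gᵟ≡1+kp : g ^ δ ≡ 1 + k * p
      gᵟ≡1+kp = trans (m≡m%n+[m/n]*n (g ^ δ) p) (cong (_+ k * p) (trans gᵟ≡1 1%p≡1))
      δp<N : δ * p < N
      δp<N = <-≤-trans (*-monoˡ-< p δ<p∸1) (≤-reflexive (*-comm (p ∸ 1) p))
      collect : ∀ k p s → 1 + p * k * p + s * (p * p) ≡ 1 + (k + s) * (p * p)
      collect = solve-∀

    ^-injective-mod-p : ∀ {m m′} → m < p ∸ 1 → m′ < p ∸ 1 → g ^ m % p ≡ g ^ m′ % p → m ≡ m′
    ^-injective-mod-p = ^-%-injective p g N (p ∸ 1) gᴺ≡1-mod-p p∸1≤N order-mod-p

    ^-injective-mod-p² : ∀ {m m′} → m < N → m′ < N → g ^ m % (p * p) ≡ g ^ m′ % (p * p) → m ≡ m′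
    ^-injective-mod-p² = ^-%-injective (p * p) g N N gᴺ≡1-mod-p² ≤-refl order-mod-p²

    ^-nonzero-mod-p : ∀ {m} → m ≤ N → 0 < g ^ m % p
    ^-nonzero-mod-p {m} m≤N = n≢0⇒n>0 λ gᵐ≡0 → 1+n≰n (≤-reflexive (begin
      1                              ≡⟨ 1%p≡1 ⟨
      1 % p                          ≡⟨ gᴺ≡1-mod-p ⟨
      g ^ N % p                      ≡⟨ cong (λ u → g ^ u % p) (m+[n∸m]≡n m≤N) ⟨
      g ^ (m + (N ∸ m)) % p          ≡⟨ cong (_% p) (^-distribˡ-+-* g m (N ∸ m)) ⟩
      (g ^ m * g ^ (N ∸ m)) % p      ≡⟨ %-cong-* p {y = g ^ (N ∸ m)} (trans gᵐ≡0 (sym 0%p≡0)) refl ⟩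
      (0 * g ^ (N ∸ m)) % p          ≡⟨ 0%p≡0 ⟩
      0                              ∎))

    ^-onto-mod-p : ∀ {z} → 0 < z → z < p → ∃[ m ] m < p ∸ 1 × g ^ m % p ≡ z
    ^-onto-mod-p {z} 0<z z<p =
      let m , m<p∸1 , hm≡z∸1 = injective⇒onto (p ∸ 1) h h-bounded h-injective (∸-monoˡ-< z<p 0<z)
      in  m , m<p∸1 , ∸-cancelʳ-≡ (nonzero m<p∸1) 0<z hm≡z∸1
      where
      h : ℕ → ℕ
      h m = g ^ m % p ∸ 1
      nonzero : ∀ {m} → m < p ∸ 1 → 0 < g ^ m % p
      nonzero m<p∸1 = ^-nonzero-mod-p (≤-trans (<⇒≤ m<p∸1) p∸1≤N)
      h-bounded : ∀ {m} → m < p ∸ 1 → h m < p ∸ 1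
      h-bounded m<p∸1 = ∸-monoˡ-< (m%n<n _ p) (nonzero m<p∸1)
      h-injective : ∀ {m m′} → m < p ∸ 1 → m′ < p ∸ 1 → h m ≡ h m′ → m ≡ m′
      h-injective m<p∸1 m′<p∸1 eq = ^-injective-mod-p m<p∸1 m′<p∸1 (∸-cancelʳ-≡ (nonzero m<p∸1) (nonzero m′<p∸1) eq)

    fermat : g ^ (p ∸ 1) % p ≡ 1 % p
    fermat = from-onto (^-onto-mod-p (^-nonzero-mod-p p∸1≤N) (m%n<n (g ^ (p ∸ 1)) p))
      where
      from-onto : (∃[ m ] m < p ∸ 1 × g ^ m % p ≡ g ^ (p ∸ 1) % p) → g ^ (p ∸ 1) % p ≡ 1 % p
      from-onto (zero  , _     , g⁰≡gᵖ⁻¹) = sym g⁰≡gᵖ⁻¹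
      from-onto (suc m , m<p∸1 , gᵐ≡gᵖ⁻¹) = contradiction
        (^-%-cancelˡ p g N gᴺ≡1-mod-p (<⇒≤ m<p∸1) p∸1≤N gᵐ≡gᵖ⁻¹)
        (order-mod-p (p ∸ 1 ∸ suc m) (m<n⇒0<n∸m m<p∸1) (∸-monoʳ-< z<s (<⇒≤ m<p∸1)))

    ^-periodic-mod-p : ∀ m s → g ^ (m + (p ∸ 1) * s) % p ≡ g ^ m % p
    ^-periodic-mod-p m zero    = cong (λ u → g ^ u % p) (trans (cong (m +_) (*-zeroʳ (p ∸ 1))) (+-identityʳ m))
    ^-periodic-mod-p m (suc s) = begin
      g ^ (m + (p ∸ 1) * suc s) % p                ≡⟨ cong (λ u → g ^ u % p) (rearrange m (p ∸ 1) s) ⟩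
      g ^ (m + (p ∸ 1) * s + (p ∸ 1)) % p          ≡⟨ cong (_% p) (^-distribˡ-+-* g (m + (p ∸ 1) * s) (p ∸ 1)) ⟩
      (g ^ (m + (p ∸ 1) * s) * g ^ (p ∸ 1)) % p    ≡⟨ %-cong-* p {g ^ (m + (p ∸ 1) * s)} refl fermat ⟩
      (g ^ (m + (p ∸ 1) * s) * 1) % p              ≡⟨ cong (_% p) (*-identityʳ _) ⟩
      g ^ (m + (p ∸ 1) * s) % p                    ≡⟨ ^-periodic-mod-p m s ⟩
      g ^ m % p                                    ∎
      where
      rearrange : ∀ m q s → m + q * (1 + s) ≡ m + q * s + q
      rearrange = solve-∀

module IntegerResidues where

  open import Data.Nat.DivMod using ([m+kn]%n≡m%n; m<n⇒m%n≡m)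
  open import Data.Integer using (+_; -[1+_]; _/ℕ_) renaming (_+_ to _+ℤ_; _*_ to _*ℤ_; _-_ to _-ℤ_; -_ to -ℤ_)
  open import Data.Integer.Properties using (+-injective; pos-+; pos-*; *-assoc)
  open import Data.Integer.DivMod using (a≡a%ℕn+[a/ℕn]*n; n%ℕd<d)
  open import Data.Integer.Tactic.RingSolver using (solve-∀)
  open import Relation.Binary.PropositionalEquality
  open ≡-Reasoning

  module _ (n : ℕ) .{{_ : NonZero n}} where

    x≡y+sn⇒x%n≡y%n : ∀ x y (s : ℤ) → + x ≡ + y +ℤ s *ℤ + n → x % n ≡ y % n
    x≡y+sn⇒x%n≡y%n x y (+ m)    eq = trans (cong (_% n) x≡y+mn) ([m+kn]%n≡m%n y m n)
      where
      x≡y+mn : x ≡ y + m * n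
      x≡y+mn = +-injective (trans eq (trans (cong (_+ℤ_ (+ y)) (sym (pos-* m n))) (sym (pos-+ y (m * n)))))
    x≡y+sn⇒x%n≡y%n x y -[1+ m ] eq = sym (x≡y+sn⇒x%n≡y%n y x (+ suc m) y≡x+[1+m]n)
      where
      move : ∀ y u n → y ≡ y +ℤ (-ℤ u) *ℤ n +ℤ u *ℤ n
      move = solve-∀
      y≡x+[1+m]n : + y ≡ + x +ℤ + suc m *ℤ + n
      y≡x+[1+m]n = trans (move (+ y) (+ suc m) (+ n)) (cong (_+ℤ + suc m *ℤ + n) (sym eq))

    x+sn≡y+tn⇒x%n≡y%n : ∀ x y (s t : ℤ) → + x +ℤ s *ℤ + n ≡ + y +ℤ t *ℤ + n → x % n ≡ y % n
    x+sn≡y+tn⇒x%n≡y%n x y s t eq = x≡y+sn⇒x%n≡y%n x y (t -ℤ s) x≡y+[t-s]n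
      where
      move : ∀ x s n → x ≡ x +ℤ s *ℤ n +ℤ (-ℤ s) *ℤ n
      move = solve-∀
      collect : ∀ y t s n → y +ℤ t *ℤ n +ℤ (-ℤ s) *ℤ n ≡ y +ℤ (t -ℤ s) *ℤ n
      collect = solve-∀
      x≡y+[t-s]n : + x ≡ + y +ℤ (t -ℤ s) *ℤ + n
      x≡y+[t-s]n = trans (move (+ x) s (+ n)) (trans (cong (_+ℤ (-ℤ s) *ℤ + n) eq) (collect (+ y) t s (+ n)))

    [b+k]%ℕn%n≡[b%ℕn+k%ℕn]%n : ∀ b k → ((b +ℤ k) %ℕ n) % n ≡ (b %ℕ n + k %ℕ n) % n
    [b+k]%ℕn%n≡[b%ℕn+k%ℕn]%n b k = x+sn≡y+tn⇒x%n≡y%n _ _ ((b +ℤ k) /ℕ n) (b /ℕ n +ℤ k /ℕ n) (begin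
      + ((b +ℤ k) %ℕ n) +ℤ (b +ℤ k) /ℕ n *ℤ + n                          ≡⟨ a≡a%ℕn+[a/ℕn]*n (b +ℤ k) n ⟨
      b +ℤ k                                                              ≡⟨ cong₂ _+ℤ_ (a≡a%ℕn+[a/ℕn]*n b n) (a≡a%ℕn+[a/ℕn]*n k n) ⟩
      (+ (b %ℕ n) +ℤ b /ℕ n *ℤ + n) +ℤ (+ (k %ℕ n) +ℤ k /ℕ n *ℤ + n)     ≡⟨ regroup (+ (b %ℕ n)) (+ (k %ℕ n)) (b /ℕ n) (k /ℕ n) (+ n) ⟩
      (+ (b %ℕ n) +ℤ + (k %ℕ n)) +ℤ (b /ℕ n +ℤ k /ℕ n) *ℤ + n            ≡⟨ cong (_+ℤ (b /ℕ n +ℤ k /ℕ n) *ℤ + n) (pos-+ (b %ℕ n) (k %ℕ n)) ⟨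
      + (b %ℕ n + k %ℕ n) +ℤ (b /ℕ n +ℤ k /ℕ n) *ℤ + n                   ∎)
      where
      regroup : ∀ x y s t n → (x +ℤ s *ℤ n) +ℤ (y +ℤ t *ℤ n) ≡ (x +ℤ y) +ℤ (s +ℤ t) *ℤ n
      regroup = solve-∀

    [b%ℕmn]%n≡b%ℕn : ∀ b m .{{_ : NonZero (m * n)}} → (b %ℕ (m * n)) % n ≡ b %ℕ n
    [b%ℕmn]%n≡b%ℕn b m = trans (x+sn≡y+tn⇒x%n≡y%n _ _ (b /ℕ (m * n) *ℤ + m) (b /ℕ n) (begin
      + (b %ℕ (m * n)) +ℤ b /ℕ (m * n) *ℤ + m *ℤ + n   ≡⟨ cong (_+ℤ_ (+ (b %ℕ (m * n)))) (trans (*-assoc (b /ℕ (m * n)) (+ m) (+ n))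
                                                                                           (cong (b /ℕ (m * n) *ℤ_) (sym (pos-* m n)))) ⟩
      + (b %ℕ (m * n)) +ℤ b /ℕ (m * n) *ℤ + (m * n)    ≡⟨ a≡a%ℕn+[a/ℕn]*n b (m * n) ⟨
      b                                                ≡⟨ a≡a%ℕn+[a/ℕn]*n b n ⟩
      + (b %ℕ n) +ℤ b /ℕ n *ℤ + n                       ∎))
      (m<n⇒m%n≡m (n%ℕd<d b n))

  modℤ≡%ℕ : ∀ v n .{{_ : NonZero n}} → v modℤ n ≡ v %ℕ n
  modℤ≡%ℕ v (suc n) = refl

record Enumerates (N A B : ℕ) (S : ℕ → Bool) (φ : ℕ → ℕ → ℕ) : Set where
  field
    onto      : ∀ y → y < N → S y ≡ true → ∃₂ λ i t → i < A × t < B × φ i t ≡ y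
    bounded   : ∀ i t → i < A → t < B → φ i t < N
    member    : ∀ i t → i < A → t < B → S (φ i t) ≡ true
    injective : ∀ i t i′ t′ → i < A → t < B → i′ < A → t′ < B →
                φ i t ≡ φ i′ t′ → i ≡ i′ × t ≡ t′

module FiniteSums {c ℓ : Level} (R : CommutativeRing c ℓ) where

  open import Data.Nat.DivMod using (m≡m%n+[m/n]*n)
  open import Relation.Binary.PropositionalEquality using (≢-sym)
  open CommutativeRing R renaming (_+_ to _+ᴿ_; _*_ to _*ᴿ_)
  open Eval R
  open import Algebra.Properties.Ring ring using (+-cancelˡ; +-inverseʳ-unique; [y-z]x≈yx-zx; x∙y⁻¹≈ε⇒x≈y)
  open import Algebra.Properties.CommutativeSemigroup +-commutativeSemigroup using (interchange)
  open import Relation.Binary.Reasoning.Setoid setoid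

  sum-cong : ∀ n {F G : ℕ → Carrier} → (∀ i → i < n → F i ≈ G i) → sumBelow n F ≈ sumBelow n G
  sum-cong zero    F≈G = refl
  sum-cong (suc n) F≈G = +-cong (sum-cong n λ i i<n → F≈G i (ℕ.m<n⇒m<1+n i<n)) (F≈G n (ℕ.n<1+n n))

  sum-zero : ∀ n {F : ℕ → Carrier} → (∀ i → i < n → F i ≈ 0#) → sumBelow n F ≈ 0#
  sum-zero n F≈0 = trans (sum-cong n F≈0) (sum-const0 n)
    where
    sum-const0 : ∀ n → sumBelow n (λ _ → 0#) ≈ 0#
    sum-const0 zero    = refl
    sum-const0 (suc n) = trans (+-identityʳ _) (sum-const0 n)

  sum-delta : ∀ n {F : ℕ → Carrier} m → m < n → (∀ i → i < n → i ≢ m → F i ≈ 0#) →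
              sumBelow n F ≈ F m
  sum-delta (suc n) m m<1+n F≈0 with ℕ.m≤n⇒m<n∨m≡n (s≤s⁻¹ m<1+n)
  ... | inj₂ ≡.refl = trans (+-congʳ (sum-zero n λ i i<n → F≈0 i (ℕ.m<n⇒m<1+n i<n) (ℕ.<⇒≢ i<n)))
                            (+-identityˡ _)
  ... | inj₁ m<n    = trans (+-cong (sum-delta n m m<n λ i i<n → F≈0 i (ℕ.m<n⇒m<1+n i<n))
                                    (F≈0 n (ℕ.n<1+n n) (λ n≡m → ℕ.<⇒≢ m<n (≡.sym n≡m))))
                            (+-identityʳ _)

  sum-+ : ∀ n (F G : ℕ → Carrier) → sumBelow n (λ i → F i +ᴿ G i) ≈ sumBelow n F +ᴿ sumBelow n G
  sum-+ zero    F G = sym (+-identityˡ 0#)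
  sum-+ (suc n) F G = trans (+-congʳ (sum-+ n F G)) (interchange _ _ _ _)

  sum-*ˡ : ∀ n x (F : ℕ → Carrier) → sumBelow n (λ i → x *ᴿ F i) ≈ x *ᴿ sumBelow n F
  sum-*ˡ zero    x F = sym (zeroʳ x)
  sum-*ˡ (suc n) x F = trans (+-congʳ (sum-*ˡ n x F)) (sym (distribˡ x _ _))

  sum-swap : ∀ n m (F : ℕ → ℕ → Carrier) →
             sumBelow n (λ i → sumBelow m (F i)) ≈ sumBelow m (λ j → sumBelow n (λ i → F i j))
  sum-swap zero    m F = sym (sum-zero m λ _ _ → refl)
  sum-swap (suc n) m F = trans (+-congʳ (sum-swap n m F)) (sym (sum-+ m _ _))

  sum-unconsˡ : ∀ n (F : ℕ → Carrier) → sumBelow (suc n) F ≈ F 0 +ᴿ sumBelow n (λ i → F (suc i))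
  sum-unconsˡ zero    F = trans (+-identityˡ _) (sym (+-identityʳ _))
  sum-unconsˡ (suc n) F = trans (+-congʳ (sum-unconsˡ n F)) (+-assoc _ _ _)

  sum-++ : ∀ m n (F : ℕ → Carrier) → sumBelow (m + n) F ≈ sumBelow m F +ᴿ sumBelow n (λ i → F (m + i))
  sum-++ m zero    F = ≡.subst (λ k → sumBelow k F ≈ sumBelow m F +ᴿ 0#) (≡.sym (ℕ.+-identityʳ m))
                               (sym (+-identityʳ _))
  sum-++ m (suc n) F = begin
    sumBelow (m + suc n) F                                   ≡⟨ ≡.cong (λ k → sumBelow k F) (ℕ.+-suc m n) ⟩
    sumBelow (m + n) F +ᴿ F (m + n)                          ≈⟨ +-congʳ (sum-++ m n F) ⟩
    sumBelow m F +ᴿ sumBelow n (λ i → F (m + i)) +ᴿ F (m + n) ≈⟨ +-assoc _ _ _ ⟩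
    sumBelow m F +ᴿ sumBelow (suc n) (λ i → F (m + i))       ∎

  sum-shift : ∀ n (F : ℕ → Carrier) → F n ≈ F 0 → sumBelow n (λ i → F (suc i)) ≈ sumBelow n F
  sum-shift zero    F _      = refl
  sum-shift (suc n) F Fn≈F0 = begin
    sumBelow n (λ i → F (suc i)) +ᴿ F (suc n) ≈⟨ +-congˡ Fn≈F0 ⟩
    sumBelow n (λ i → F (suc i)) +ᴿ F 0       ≈⟨ +-comm _ _ ⟩
    F 0 +ᴿ sumBelow n (λ i → F (suc i))       ≈⟨ sum-unconsˡ n F ⟨
    sumBelow (suc n) F                        ∎

  sum-rotate : ∀ n (F : ℕ → Carrier) → (∀ i → F (n + i) ≈ F i) →
               ∀ w → sumBelow n (λ i → F (i + w)) ≈ sumBelow n F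
  sum-rotate n F periodic zero    = sum-cong n λ i _ → reflexive (≡.cong F (ℕ.+-identityʳ i))
  sum-rotate n F periodic (suc w) = begin
    sumBelow n (λ i → F (i + suc w)) ≈⟨ sum-cong n (λ i _ → reflexive (≡.cong F (ℕ.+-suc i w))) ⟩
    sumBelow n (λ i → F (suc i + w)) ≈⟨ sum-shift n (λ i → F (i + w)) (periodic w) ⟩
    sumBelow n (λ i → F (i + w))     ≈⟨ sum-rotate n F periodic w ⟩
    sumBelow n F                     ∎

  sum-periodic : ∀ n (F : ℕ → Carrier) → (∀ i → F (n + i) ≈ F i) →
                 ∀ h → sumBelow (h * n) F ≈ sumBelow h (λ _ → sumBelow n F)
  sum-periodic n F periodic zero    = refl
  sum-periodic n F periodic (suc h) = begin
    sumBelow (n + h * n) F                                ≈⟨ sum-++ n (h * n) F ⟩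
    sumBelow n F +ᴿ sumBelow (h * n) (λ i → F (n + i))    ≈⟨ +-congˡ (sum-cong (h * n) λ i _ → periodic i) ⟩
    sumBelow n F +ᴿ sumBelow (h * n) F                    ≈⟨ +-congˡ (sum-periodic n F periodic h) ⟩
    sumBelow n F +ᴿ sumBelow h (λ _ → sumBelow n F)       ≈⟨ +-comm _ _ ⟩
    sumBelow (suc h) (λ _ → sumBelow n F)                 ∎

  sum-enumerate : ∀ {N A B S φ} → Enumerates N A B S φ → (h : ℕ → Carrier) →
                  sumBelow N (λ y → if S y then h y else 0#)
                    ≈ sumBelow A (λ i → sumBelow B (λ t → h (φ i t)))
  sum-enumerate {N} {A} {B} {S} {φ} enum h = begin
    sumBelow N (λ y → if S y then h y else 0#)                       ≈⟨ sum-cong N indicator≈hits ⟩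
    sumBelow N (λ y → sumBelow A (λ i → sumBelow B (λ t → δ i t y))) ≈⟨ sum-swap N A _ ⟩
    sumBelow A (λ i → sumBelow N (λ y → sumBelow B (λ t → δ i t y))) ≈⟨ sum-cong A (λ i _ → sum-swap N B _) ⟩
    sumBelow A (λ i → sumBelow B (λ t → sumBelow N (δ i t)))         ≈⟨ sum-cong A (λ i i<A → sum-cong B λ t t<B →
                                                                          sum-delta N (φ i t) (bounded i t i<A t<B)
                                                                            (λ y _ y≢φ → δ-miss i t y (≢-sym y≢φ))) ⟩
    sumBelow A (λ i → sumBelow B (λ t → δ i t (φ i t)))              ≈⟨ sum-cong A (λ i _ → sum-cong B λ t _ → δ-hit i t) ⟩
    sumBelow A (λ i → sumBelow B (λ t → h (φ i t)))                  ∎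
    where
    open Enumerates enum

    δ : ℕ → ℕ → ℕ → Carrier
    δ i t y = if φ i t ≡ᵇ y then h y else 0#

    δ-hit : ∀ i t → δ i t (φ i t) ≈ h (φ i t)
    δ-hit i t with φ i t ≡ᵇ φ i t in eq
    ... | true  = refl
    ... | false = contradiction (≡.subst T eq (ℕ.≡⇒≡ᵇ (φ i t) _ ≡.refl)) λ ()

    δ-miss : ∀ i t y → φ i t ≢ y → δ i t y ≈ 0#
    δ-miss i t y φ≢y with φ i t ≡ᵇ y in eq
    ... | false = refl
    ... | true  = contradiction (ℕ.≡ᵇ⇒≡ (φ i t) y (≡.subst T (≡.sym eq) _)) φ≢y

    indicator≈hits : ∀ y → y < N → (if S y then h y else 0#) ≈ sumBelow A (λ i → sumBelow B (λ t → δ i t y))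
    indicator≈hits y y<N with S y in Sy
    ... | false = sym (sum-zero A λ i i<A → sum-zero B λ t t<B → δ-miss i t y λ φ≡y →
                    contradiction (≡.trans (≡.sym (member i t i<A t<B)) (≡.trans (≡.cong S φ≡y) Sy)) λ ())
    ... | true with onto y y<N Sy
    ...   | i₀ , t₀ , i₀<A , t₀<B , ≡.refl = sym (begin
      sumBelow A (λ i → sumBelow B (λ t → δ i t y)) ≈⟨ sum-delta A i₀ i₀<A (λ i i<A i≢i₀ → sum-zero B λ t t<B →
                                                         δ-miss i t y λ φ≡ → i≢i₀ (proj₁ (injective _ _ _ _ i<A t<B i₀<A t₀<B φ≡))) ⟩
      sumBelow B (λ t → δ i₀ t y)                   ≈⟨ sum-delta B t₀ t₀<B (λ t t<B t≢t₀ →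
                                                         δ-miss i₀ t y λ φ≡ → t≢t₀ (proj₂ (injective _ _ _ _ i₀<A t<B i₀<A t₀<B φ≡))) ⟩
      δ i₀ t₀ y                                     ≈⟨ δ-hit i₀ t₀ ⟩
      h y                                           ∎)

  pow-+ : ∀ x m n → pow x (m + n) ≈ pow x m *ᴿ pow x n
  pow-+ x zero    n = sym (*-identityˡ _)
  pow-+ x (suc m) n = trans (*-congˡ (pow-+ x m n)) (sym (*-assoc _ _ _))

  pow-cong : ∀ {x y} n → x ≈ y → pow x n ≈ pow y n
  pow-cong zero    x≈y = refl
  pow-cong (suc n) x≈y = *-cong x≈y (pow-cong n x≈y)

  pow-* : ∀ x m n → pow x (m * n) ≈ pow (pow x m) n
  pow-* x m zero    = reflexive (≡.cong (pow x) (ℕ.*-zeroʳ m))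
  pow-* x m (suc n) = begin
    pow x (m * suc n)         ≡⟨ ≡.cong (pow x) (ℕ.*-suc m n) ⟩
    pow x (m + m * n)         ≈⟨ pow-+ x m (m * n) ⟩
    pow x m *ᴿ pow x (m * n)  ≈⟨ *-congˡ (pow-* x m n) ⟩
    pow (pow x m) (suc n)     ∎

  pow-1# : ∀ n → pow 1# n ≈ 1#
  pow-1# zero    = refl
  pow-1# (suc n) = trans (*-identityˡ _) (pow-1# n)

  pow-multiple : ∀ {x} n k → pow x n ≈ 1# → pow x (n * k) ≈ 1#
  pow-multiple {x} n k xⁿ≈1 = trans (pow-* x n k) (trans (pow-cong k xⁿ≈1) (pow-1# k))

  pow-% : ∀ {x} n .{{_ : NonZero n}} → pow x n ≈ 1# → ∀ m → pow x m ≈ pow x (m % n)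
  pow-% {x} n xⁿ≈1 m = begin
    pow x m                            ≡⟨ ≡.cong (pow x) (≡.trans (m≡m%n+[m/n]*n m n) (≡.cong (m % n +_) (ℕ.*-comm (m / n) n))) ⟩
    pow x (m % n + n * (m / n))        ≈⟨ pow-+ x (m % n) _ ⟩
    pow x (m % n) *ᴿ pow x (n * (m / n)) ≈⟨ *-congˡ (pow-multiple n (m / n) xⁿ≈1) ⟩
    pow x (m % n) *ᴿ 1#                ≈⟨ *-identityʳ _ ⟩
    pow x (m % n)                      ∎

  evalSet-cong : ∀ N S {x y} → x ≈ y → evalSet N S x ≈ evalSet N S y
  evalSet-cong N S {x} {y} x≈y = sum-cong N λ t _ → term (S t) t
    where
    term : ∀ b t → (if b then pow x t else 0#) ≈ (if b then pow y t else 0#)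
    term true  t = pow-cong t x≈y
    term false t = refl

  sum-pow-unconsˡ : ∀ n x → sumBelow (suc n) (pow x) ≈ 1# +ᴿ x *ᴿ sumBelow n (pow x)
  sum-pow-unconsˡ n x = trans (sum-unconsˡ n (pow x)) (+-congˡ (sum-*ˡ n x (pow x)))

  module _ (isField : IsField) where

    x*y≈y⇒y≈0 : ∀ {x y} → ¬ x ≈ 1# → x *ᴿ y ≈ y → y ≈ 0#
    x*y≈y⇒y≈0 {x} {y} x≉1 xy≈y = begin
      y                  ≈⟨ *-identityˡ y ⟨
      1# *ᴿ y            ≈⟨ *-congʳ w*[x-1]≈1 ⟨
      w *ᴿ (x - 1#) *ᴿ y ≈⟨ *-assoc _ _ _ ⟩
      w *ᴿ ((x - 1#) *ᴿ y) ≈⟨ *-congˡ [x-1]y≈0 ⟩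
      w *ᴿ 0#            ≈⟨ zeroʳ w ⟩
      0#                 ∎
      where
      [x-1]y≈0 : (x - 1#) *ᴿ y ≈ 0#
      [x-1]y≈0 = begin
        (x - 1#) *ᴿ y       ≈⟨ [y-z]x≈yx-zx y x 1# ⟩
        x *ᴿ y - 1# *ᴿ y    ≈⟨ +-cong xy≈y (-‿cong (*-identityˡ y)) ⟩
        y - y               ≈⟨ -‿inverseʳ y ⟩
        0#                  ∎
      x-1≉0 : ¬ x - 1# ≈ 0#
      x-1≉0 x-1≈0 = x≉1 (x∙y⁻¹≈ε⇒x≈y x 1# x-1≈0)
      w = proj₁ (proj₂ isField (x - 1#) x-1≉0)
      w*[x-1]≈1 : w *ᴿ (x - 1#) ≈ 1#
      w*[x-1]≈1 = trans (*-comm _ _) (proj₂ (proj₂ isField (x - 1#) x-1≉0))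

    sum-rootOfUnity : ∀ n {x} → pow x n ≈ 1# → ¬ x ≈ 1# → sumBelow n (pow x) ≈ 0#
    sum-rootOfUnity n {x} xⁿ≈1 x≉1 = x*y≈y⇒y≈0 x≉1 (sym (+-cancelˡ 1# _ _ (begin
      1# +ᴿ Σ        ≈⟨ +-comm _ _ ⟩
      Σ +ᴿ 1#        ≈⟨ +-congˡ xⁿ≈1 ⟨
      Σ +ᴿ pow x n   ≈⟨ sum-pow-unconsˡ n x ⟩
      1# +ᴿ x *ᴿ Σ   ∎)))
      where Σ = sumBelow n (pow x)

  module _ (char2 : Char2) where

    x+x≈0 : ∀ x → x +ᴿ x ≈ 0#
    x+x≈0 x = begin
      x +ᴿ x               ≈⟨ +-cong (*-identityˡ x) (*-identityˡ x) ⟨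
      1# *ᴿ x +ᴿ 1# *ᴿ x   ≈⟨ distribʳ x 1# 1# ⟨
      (1# +ᴿ 1#) *ᴿ x      ≈⟨ *-congʳ char2 ⟩
      0# *ᴿ x              ≈⟨ zeroˡ x ⟩
      0#                   ∎

    x+y≈0⇒y≈x : ∀ {x y} → x +ᴿ y ≈ 0# → y ≈ x
    x+y≈0⇒y≈x {x} {y} x+y≈0 = trans (+-inverseʳ-unique x y x+y≈0) (sym (+-inverseʳ-unique x x (x+x≈0 x)))

    sum-ones≈parity : ∀ n → sumBelow n (λ _ → 1#) ≈ parity n
    sum-ones≈parity zero          = refl
    sum-ones≈parity (suc zero)    = +-identityˡ 1#
    sum-ones≈parity (suc (suc n)) = begin
      sumBelow n (λ _ → 1#) +ᴿ 1# +ᴿ 1#    ≈⟨ +-assoc _ _ _ ⟩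
      sumBelow n (λ _ → 1#) +ᴿ (1# +ᴿ 1#)  ≈⟨ +-congˡ char2 ⟩
      sumBelow n (λ _ → 1#) +ᴿ 0#          ≈⟨ +-identityʳ _ ⟩
      sumBelow n (λ _ → 1#)                ≈⟨ sum-ones≈parity n ⟩
      parity n                             ∎

    sum-positive-rootOfUnity : IsField → ∀ n {x} → 0 < n → pow x n ≈ 1# → ¬ x ≈ 1# →
                               sumBelow n (λ z → if 0 <ᵇ z then pow x z else 0#) ≈ 1#
    sum-positive-rootOfUnity isField (suc q) {x} _ xⁿ≈1 x≉1 = begin
      sumBelow (suc q) (λ z → if 0 <ᵇ z then pow x z else 0#) ≈⟨ sum-unconsˡ q _ ⟩
      0# +ᴿ sumBelow q (λ z → x *ᴿ pow x z)                   ≈⟨ +-identityˡ _ ⟩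
      sumBelow q (λ z → x *ᴿ pow x z)                         ≈⟨ sum-*ˡ q x (pow x) ⟩
      x *ᴿ sumBelow q (pow x)                                 ≈⟨ x+y≈0⇒y≈x 1+xΣ≈0 ⟩
      1#                                                      ∎
      where
      1+xΣ≈0 : 1# +ᴿ x *ᴿ sumBelow q (pow x) ≈ 0#
      1+xΣ≈0 = trans (sym (sum-pow-unconsˡ q x)) (sum-rootOfUnity isField (suc q) xⁿ≈1 x≉1)

module Membership where

  open import Data.Bool using (_∨_)
  open import Data.Bool.Properties using (∨-zeroʳ)
  open import Data.Nat.Properties using (≤-refl; m<n⇒m<1+n; m≤n⇒m<n∨m≡n; ≡ᵇ⇒≡; ≡⇒≡ᵇ)
  open import Relation.Binary.PropositionalEquality
  open Residues using (modℕ≡%)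

  anyBelow-sound : ∀ n P → anyBelow n P ≡ true → ∃[ s ] s < n × P s ≡ true
  anyBelow-sound (suc n) P any with anyBelow n P in eq
  ... | true  = let s , s<n , Ps = anyBelow-sound n P eq in s , m<n⇒m<1+n s<n , Ps
  ... | false = n , ≤-refl , any

  anyBelow-complete : ∀ n P {s} → s < n → P s ≡ true → anyBelow n P ≡ true
  anyBelow-complete (suc n) P {s} s<1+n Ps with m≤n⇒m<n∨m≡n (s≤s⁻¹ s<1+n)
  ... | inj₂ refl = trans (cong (anyBelow n P ∨_) Ps) (∨-zeroʳ _)
  ... | inj₁ s<n  = cong (_∨ P n) (anyBelow-complete n P s<n Ps)

  anyBelow-false : ∀ n P → anyBelow n P ≡ false → ∀ {s} → s < n → P s ≡ false
  anyBelow-false n P none {s} s<n with P s in Ps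
  ... | false = refl
  ... | true  = contradiction (trans (sym (anyBelow-complete n P s<n Ps)) none) λ ()

  ≡ᵇ-true⇒≡ : ∀ {m n} → (m ≡ᵇ n) ≡ true → m ≡ n
  ≡ᵇ-true⇒≡ {m} {n} eq = ≡ᵇ⇒≡ m n (subst T (sym eq) _)

  ≡⇒≡ᵇ-true : ∀ {m n} → m ≡ n → (m ≡ᵇ n) ≡ true
  ≡⇒≡ᵇ-true {m} refl with m ≡ᵇ m | ≡⇒≡ᵇ m m refl
  ... | true | _ = refl

  module CyclotomicClasses (p g e f : ℕ) .{{_ : NonZero p}} where

    open Cyclotomy p g e f

    memD-sound : ∀ n d i x .{{_ : NonZero n}} → memD n d i x ≡ true →
                 ∃[ t ] t < e × g ^ (i + d * t) % n ≡ x % n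
    memD-sound n d i x mem =
      let t , t<e , eq = anyBelow-sound e _ mem
      in  t , t<e , trans (sym (modℕ≡% _ n)) (trans (≡ᵇ-true⇒≡ eq) (modℕ≡% x n))

    memD-complete : ∀ n d i x {t} .{{_ : NonZero n}} → t < e → g ^ (i + d * t) % n ≡ x % n →
                    memD n d i x ≡ true
    memD-complete n d i x t<e eq =
      anyBelow-complete e _ t<e (≡⇒≡ᵇ-true (trans (modℕ≡% _ n) (trans eq (sym (modℕ≡% x n)))))

    memPDp-sound : ∀ c y → memPDp c y ≡ true →
                   ∃[ x ] x < p × memDp c x ≡ true × (p * x) modℕ (p * p) ≡ y modℕ (p * p)
    memPDp-sound c y mem with anyBelow-sound p _ mem
    ... | x , x<p , px with memDp c x in memx | px
    ...   | true | eq = x , x<p , memx , ≡ᵇ-true⇒≡ eq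

    -- The conjunction inside memPDp is local to Defs and cannot be named, hence the detour
    -- through anyBelow-false.
    memPDp-complete : ∀ c {x} → x < p → memDp c x ≡ true → memPDp c (p * x) ≡ true
    memPDp-complete c {x} x<p memx with memPDp c (p * x) in mem
    ... | true  = refl
    ... | false with memDp c x | anyBelow-false p _ mem x<p | memx
    ...   | true | px≢px | _ = contradiction (trans (sym (≡⇒≡ᵇ-true {(p * x) modℕ (p * p)} refl)) px≢px) λ ()

module CyclotomicSetting (p e f g : ℕ) .{{_ : NonZero f}} (1<p : 1 < p) (p∸1≡ef : p ∸ 1 ≡ e * f)
                         (prim : IsPrimitiveRoot (p * p) (p * (p ∸ 1)) g) where

  open import Data.Nat.Properties
  open import Data.Nat.DivMod
  open import Data.Nat.Divisibility using (n∣m*n)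
  open import Data.Nat.Tactic.RingSolver using (solve-∀)
  open import Data.Integer.DivMod using (n%ℕd<d)
  open import Relation.Binary.PropositionalEquality
  open ≡-Reasoning
  open Residues
  open IntegerResidues using ([b+k]%ℕn%n≡[b%ℕn+k%ℕn]%n; [b%ℕmn]%n≡b%ℕn; modℤ≡%ℕ)
  open Membership

  open PrimitiveRootModSquare p g 1<p prim public
  open Cyclotomy p g e f
  open CyclotomicClasses p g e f

  instance
    pf≢0 : NonZero (p * f)
    pf≢0 = m*n≢0 p f

  f*e≡p∸1 : f * e ≡ p ∸ 1
  f*e≡p∸1 = trans (*-comm f e) (sym p∸1≡ef)

  pf*e≡N : p * f * e ≡ N
  pf*e≡N = trans (*-assoc p f e) (cong (p *_) f*e≡p∸1)

  shifted : (n : ℕ) .{{_ : NonZero n}} → ℤ → ℕ → ℕ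
  shifted n v i = (i + v %ℕ n) % n

  shifted-modℕ : ∀ n .{{_ : NonZero n}} v i → ((i + v modℤ n) modℕ n) modℕ n ≡ shifted n v i
  shifted-modℕ n v i = begin
    ((i + v modℤ n) modℕ n) modℕ n  ≡⟨ modℕ≡% _ n ⟩
    ((i + v modℤ n) modℕ n) % n     ≡⟨ cong (_% n) (modℕ≡% _ n) ⟩
    (i + v modℤ n) % n % n          ≡⟨ m%n%n≡m%n _ n ⟩
    (i + v modℤ n) % n              ≡⟨ cong (λ u → (i + u) % n) (modℤ≡%ℕ v n) ⟩
    (i + v %ℕ n) % n                ∎

  shifted-injective : ∀ n .{{_ : NonZero n}} v {i i′} → i < n → i′ < n → shifted n v i ≡ shifted n v i′ → i ≡ i′
  shifted-injective n v = +-%-injectiveˡ n (v %ℕ n)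

  shifted-pf-mod-f : ∀ K v i → (K + shifted (p * f) v i) % f ≡ (i + (K + v %ℕ (p * f))) % f
  shifted-pf-mod-f K v i = begin
    (K + (i + w) % (p * f)) % f  ≡⟨ %-cong-+ f {K} refl (m∣n⇒o%n%m≡o%m f (p * f) (i + w) (n∣m*n p)) ⟩
    (K + (i + w)) % f            ≡⟨ cong (_% f) (regroup K i w) ⟩
    (i + (K + w)) % f            ∎
    where
    w = v %ℕ (p * f)
    regroup : ∀ K i w → K + (i + w) ≡ i + (K + w)
    regroup = solve-∀

  shifted-sum-mod-f : ∀ {K} b k → K % f ≡ k modℤ f % f →
                      ∀ i → shifted f (b Data.Integer.+ k) i % f ≡ (i + (K + b %ℕ (p * f))) % f
  shifted-sum-mod-f {K} b k K≡k i = begin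
    (i + (b Data.Integer.+ k) %ℕ f) % f % f  ≡⟨ m%n%n≡m%n _ f ⟩
    (i + (b Data.Integer.+ k) %ℕ f) % f      ≡⟨ %-cong-+ f {i} refl ([b+k]%ℕn%n≡[b%ℕn+k%ℕn]%n f b k) ⟩
    (i + (b %ℕ f + k %ℕ f)) % f              ≡⟨ cong (λ u → (i + u) % f) (+-comm (b %ℕ f) (k %ℕ f)) ⟩
    (i + (k %ℕ f + b %ℕ f)) % f              ≡⟨ %-cong-+ f {i} refl (%-cong-+ f K≡k%ℕf b%ℕpf≡b%ℕf) ⟨
    (i + (K + b %ℕ (p * f))) % f             ∎
    where
    K≡k%ℕf : K % f ≡ k %ℕ f % f
    K≡k%ℕf = trans K≡k (cong (_% f) (modℤ≡%ℕ k f))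
    b%ℕpf≡b%ℕf : b %ℕ (p * f) % f ≡ b %ℕ f % f
    b%ℕpf≡b%ℕf = trans ([b%ℕmn]%n≡b%ℕn f b p) (sym (m<n⇒m%n≡m (n%ℕd<d b f)))

  Dp-elem : ℕ → ℕ → ℕ
  Dp-elem i t = g ^ (i + f * t) % p

  Hp-elem : ℤ → ℕ → ℕ → ℕ
  Hp-elem v i t = p * Dp-elem (shifted f v i) t

  Hp²-elem : ℤ → ℕ → ℕ → ℕ
  Hp²-elem v i t = g ^ (shifted (p * f) v i + p * f * t) % (p * p)

  Dp-exponent<p∸1 : ∀ {c t} → c < f → t < e → c + f * t < p ∸ 1
  Dp-exponent<p∸1 c<f t<e = <-≤-trans (c+d*t<d*e c<f t<e) (≤-reflexive f*e≡p∸1)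

  Dp-elem-injective : ∀ {c c′ t t′} → c < f → t < e → c′ < f → t′ < e → Dp-elem c t ≡ Dp-elem c′ t′ → c ≡ c′ × t ≡ t′
  Dp-elem-injective c<f t<e c′<f t′<e eq = divMod-unique f c<f c′<f
    (^-injective-mod-p (Dp-exponent<p∸1 c<f t<e) (Dp-exponent<p∸1 c′<f t′<e) eq)

  nonzero-residues-enumerate : Enumerates p f e (0 <ᵇ_) Dp-elem
  nonzero-residues-enumerate = record
    { onto      = onto
    ; bounded   = λ _ _ _ _ → m%n<n _ p
    ; member    = λ i t i<f t<e → positive (^-nonzero-mod-p (≤-trans (<⇒≤ (Dp-exponent<p∸1 i<f t<e)) p∸1≤N))
    ; injective = λ _ _ _ _ → Dp-elem-injective
    }
    where
    positive : ∀ {y} → 0 < y → (0 <ᵇ y) ≡ true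
    positive z<s = refl
    onto : ∀ y → y < p → (0 <ᵇ y) ≡ true → ∃₂ λ i t → i < f × t < e × Dp-elem i t ≡ y
    onto (suc y) y<p _ =
      let m , m<p∸1 , gᵐ≡y = ^-onto-mod-p z<s y<p
      in  m % f , m / f , m%n<n m f , m<n*o⇒m/o<n (<-≤-trans m<p∸1 (≤-reflexive p∸1≡ef)) ,
          trans (cong (λ u → g ^ u % p) (sym (trans (m≡m%n+[m/n]*n m f) (cong (m % f +_) (*-comm (m / f) f))))) gᵐ≡y

  Hp-enumerate : ∀ v → Enumerates (p * p) (f / 2) e (memHp v) (Hp-elem v)
  Hp-enumerate v = record
    { onto      = onto
    ; bounded   = λ _ _ _ _ → *-monoʳ-< p (m%n<n _ p)
    ; member    = member
    ; injective = injective
    }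
    where
    sub : ℕ → ℕ
    sub i = (i + v modℤ f) modℕ f

    i<f : ∀ {i} → i < f / 2 → i < f
    i<f i<f/2 = <-≤-trans i<f/2 (m/n≤m f 2)

    onto : ∀ y → y < p * p → memHp v y ≡ true → ∃₂ λ i t → i < f / 2 × t < e × Hp-elem v i t ≡ y
    onto y y<p² mem =
      let i , i<f/2 , memi = anyBelow-sound (f / 2) _ mem
          x , x<p , memx , px≡y = memPDp-sound (sub i) y memi
          t , t<e , gᵗ≡x = memD-sound p f (sub i modℕ f) x memx
          px<p² = *-monoʳ-< p x<p
      in  i , t , i<f/2 , t<e , (begin
            p * (g ^ (shifted f v i + f * t) % p)      ≡⟨ cong (λ u → p * (g ^ (u + f * t) % p)) (shifted-modℕ f v i) ⟨
            p * (g ^ (sub i modℕ f + f * t) % p)       ≡⟨ cong (p *_) (trans gᵗ≡x (m<n⇒m%n≡m x<p)) ⟩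
            p * x                                      ≡⟨ m<n⇒m%n≡m px<p² ⟨
            (p * x) % (p * p)                          ≡⟨ trans (sym (modℕ≡% _ (p * p))) (trans px≡y (modℕ≡% y (p * p))) ⟩
            y % (p * p)                                ≡⟨ m<n⇒m%n≡m y<p² ⟩
            y                                          ∎)

    member : ∀ i t → i < f / 2 → t < e → memHp v (Hp-elem v i t) ≡ true
    member i t i<f/2 t<e = anyBelow-complete (f / 2) _ i<f/2
      (memPDp-complete (sub i) (m%n<n _ p) (memD-complete p f (sub i modℕ f) (Dp-elem (shifted f v i) t) t<e
        (trans (cong (λ u → g ^ (u + f * t) % p) (shifted-modℕ f v i)) (sym (m%n%n≡m%n _ p)))))

    injective : ∀ i t i′ t′ → i < f / 2 → t < e → i′ < f / 2 → t′ < e →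
                Hp-elem v i t ≡ Hp-elem v i′ t′ → i ≡ i′ × t ≡ t′
    injective i t i′ t′ i<f/2 t<e i′<f/2 t′<e eq =
      let sub≡ , t≡t′ = Dp-elem-injective (m%n<n _ f) t<e (m%n<n _ f) t′<e (*-cancelˡ-≡ _ _ p eq)
      in  shifted-injective f v (i<f i<f/2) (i<f i′<f/2) sub≡ , t≡t′

  Hp²-enumerate : ∀ v → Enumerates (p * p) (p * f / 2) e (memHp2 v) (Hp²-elem v)
  Hp²-enumerate v = record
    { onto      = onto
    ; bounded   = λ _ _ _ _ → m%n<n _ (p * p)
    ; member    = member
    ; injective = injective
    }
    where
    sub : ℕ → ℕ
    sub i = (i + v modℤ (p * f)) modℕ (p * f)

    i<pf : ∀ {i} → i < p * f / 2 → i < p * f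
    i<pf i<pf/2 = <-≤-trans i<pf/2 (m/n≤m (p * f) 2)

    onto : ∀ y → y < p * p → memHp2 v y ≡ true → ∃₂ λ i t → i < p * f / 2 × t < e × Hp²-elem v i t ≡ y
    onto y y<p² mem =
      let i , i<pf/2 , memi = anyBelow-sound (p * f / 2) _ mem
          t , t<e , gᵗ≡y = memD-sound (p * p) (p * f) (sub i modℕ (p * f)) y memi
      in  i , t , i<pf/2 , t<e ,
          trans (cong (λ u → g ^ (u + p * f * t) % (p * p)) (sym (shifted-modℕ (p * f) v i)))
                (trans gᵗ≡y (m<n⇒m%n≡m y<p²))

    member : ∀ i t → i < p * f / 2 → t < e → memHp2 v (Hp²-elem v i t) ≡ true
    member i t i<pf/2 t<e = anyBelow-complete (p * f / 2) _ i<pf/2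
      (memD-complete (p * p) (p * f) (sub i modℕ (p * f)) (Hp²-elem v i t) t<e
        (trans (cong (λ u → g ^ (u + p * f * t) % (p * p)) (shifted-modℕ (p * f) v i)) (sym (m%n%n≡m%n _ (p * p)))))

    injective : ∀ i t i′ t′ → i < p * f / 2 → t < e → i′ < p * f / 2 → t′ < e →
                Hp²-elem v i t ≡ Hp²-elem v i′ t′ → i ≡ i′ × t ≡ t′
    injective i t i′ t′ i<pf/2 t<e i′<pf/2 t′<e eq =
      let sub≡ , t≡t′ = divMod-unique (p * f) (m%n<n _ (p * f)) (m%n<n _ (p * f))
                          (^-injective-mod-p² (bound t<e) (bound t′<e) eq)
      in  shifted-injective (p * f) v (i<pf i<pf/2) (i<pf i′<pf/2) sub≡ , t≡t′
      where
      bound : ∀ {i t} → t < e → shifted (p * f) v i + p * f * t < N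
      bound t<e = <-≤-trans (c+d*t<d*e (m%n<n _ (p * f)) t<e) (≤-reflexive pf*e≡N)

  memPDp-decode : ∀ c {a} → a < p * p → memPDp c a ≡ true → ∃[ K ] K % f ≡ c % f × a ≡ p * (g ^ K % p)
  memPDp-decode c {a} a<p² mem =
    let x , x<p , memx , px≡a = memPDp-sound c a mem
        t , t<e , gᴷ≡x = memD-sound p f (c modℕ f) x memx
        K = c modℕ f + f * t
        px<p² = *-monoʳ-< p x<p
    in  K , (begin
          (c modℕ f + f * t) % f   ≡⟨ cong (λ u → (c modℕ f + u) % f) (*-comm f t) ⟩
          (c modℕ f + t * f) % f   ≡⟨ [m+kn]%n≡m%n (c modℕ f) t f ⟩
          c modℕ f % f             ≡⟨ cong (_% f) (modℕ≡% c f) ⟩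
          c % f % f                ≡⟨ m%n%n≡m%n c f ⟩
          c % f                    ∎) ,
        (begin
          a                        ≡⟨ m<n⇒m%n≡m a<p² ⟨
          a % (p * p)              ≡⟨ trans (sym (modℕ≡% a (p * p))) (trans (sym px≡a) (modℕ≡% _ (p * p))) ⟩
          (p * x) % (p * p)        ≡⟨ m<n⇒m%n≡m px<p² ⟩
          p * x                    ≡⟨ cong (p *_) (trans gᴷ≡x (m<n⇒m%n≡m x<p)) ⟨
          p * (g ^ K % p)          ∎)

module CyclotomicEvaluation {c ℓ : Level} (R : CommutativeRing c ℓ) (isField : Eval.IsField R) (char2 : Eval.Char2 R)
                            (p e f g : ℕ) .{{_ : NonZero f}} (1<p : 1 < p) (p∸1≡ef : p ∸ 1 ≡ e * f)
                            (f₂ : ℕ) (f≡2f₂ : f ≡ 2 * f₂)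
                            (prim : IsPrimitiveRoot (p * p) (p * (p ∸ 1)) g)
                            (β : CommutativeRing.Carrier R) (β-primitive : Eval.IsPrimitiveRootOfUnity R (p * p) β) where

  open import Data.Nat.DivMod using (m≡m%n+[m/n]*n; m%n%n≡m%n; m*n%n≡0; m*n/n≡m)
  open import Data.Nat.Tactic.RingSolver using (solve-∀)
  open Residues using (%-cong-*; m*[2*n]/2≡m*n; [1+m*[2*n]]*[2*n]/2≡m*n*[2*n]+n)

  open CyclotomicSetting p e f g 1<p p∸1≡ef prim public
  open Cyclotomy p g e f
  open CommutativeRing R renaming (_+_ to _+ᴿ_; _*_ to _*ᴿ_)
  open Eval R
  open FiniteSums R
  open import Relation.Binary.Reasoning.Setoid setoid

  γ : Carrier
  γ = pow β p

  γᵖ≈1 : pow γ p ≈ 1#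
  γᵖ≈1 = trans (sym (pow-* β p p)) (proj₁ β-primitive)

  γ≉1 : ¬ γ ≈ 1#
  γ≉1 = proj₂ β-primitive p (ℕ.<-trans z<s 1<p) p<p²
    where
    p<p² : p < p * p
    p<p² = ≡.subst (_< p * p) (ℕ.*-identityʳ p) (ℕ.*-monoʳ-< p 1<p)

  G : ℕ → Carrier
  G m = pow γ (g ^ m % p)

  gaussPeriod : ℕ → Carrier
  gaussPeriod c = sumBelow e (λ t → G (c + f * t))

  G-periodic : ∀ m s → G (m + (p ∸ 1) * s) ≈ G m
  G-periodic m s = reflexive (≡.cong (pow γ) (^-periodic-mod-p m s))

  gaussPeriod-+f : ∀ c → gaussPeriod (c + f) ≈ gaussPeriod c
  gaussPeriod-+f c = begin
    sumBelow e (λ t → G (c + f + f * t))   ≈⟨ sum-cong e (λ t _ → reflexive (≡.cong G (shift c f t))) ⟩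
    sumBelow e (λ t → H (t + 1))           ≈⟨ sum-rotate e H H-periodic 1 ⟩
    sumBelow e H                           ∎
    where
    H : ℕ → Carrier
    H t = G (c + f * t)
    shift : ∀ c f t → c + f + f * t ≡ c + f * (t + 1)
    shift = solve-∀
    H-periodic : ∀ t → H (e + t) ≈ H t
    H-periodic t = trans (reflexive (≡.cong G (≡.trans (expand c f e t) (≡.cong (λ u → c + f * t + u * 1) f*e≡p∸1))))
                         (G-periodic (c + f * t) 1)
      where
      expand : ∀ c f e t → c + f * (e + t) ≡ c + f * t + f * e * 1
      expand = solve-∀

  gaussPeriod-+f* : ∀ c s → gaussPeriod (c + f * s) ≈ gaussPeriod c
  gaussPeriod-+f* c zero    = reflexive (≡.cong gaussPeriod (≡.trans (≡.cong (c +_) (ℕ.*-zeroʳ f)) (ℕ.+-identityʳ c)))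
  gaussPeriod-+f* c (suc s) = begin
    gaussPeriod (c + f * suc s)  ≡⟨ ≡.cong gaussPeriod (rearrange c f s) ⟩
    gaussPeriod (c + f * s + f)  ≈⟨ gaussPeriod-+f (c + f * s) ⟩
    gaussPeriod (c + f * s)      ≈⟨ gaussPeriod-+f* c s ⟩
    gaussPeriod c                ∎
    where
    rearrange : ∀ c f s → c + f * suc s ≡ c + f * s + f
    rearrange = solve-∀

  gaussPeriod-% : ∀ {c c′} → c % f ≡ c′ % f → gaussPeriod c ≈ gaussPeriod c′
  gaussPeriod-% {c} {c′} c≡c′ = trans (reduce c) (trans (reflexive (≡.cong gaussPeriod c≡c′)) (sym (reduce c′)))
    where
    reduce : ∀ c → gaussPeriod c ≈ gaussPeriod (c % f)
    reduce c = trans (reflexive (≡.cong gaussPeriod (≡.trans (m≡m%n+[m/n]*n c f) (≡.cong (c % f +_) (ℕ.*-comm (c / f) f)))))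
                     (gaussPeriod-+f* (c % f) (c / f))

  -- The residues g^(i + f t) mod p are exactly the nonzero ones, so the Gaussian periods add up to
  -- the sum of all nontrivial p-th roots of unity.
  gaussPeriods-sum : sumBelow f gaussPeriod ≈ 1#
  gaussPeriods-sum = begin
    sumBelow f gaussPeriod                                     ≈⟨ sum-enumerate nonzero-residues-enumerate (pow γ) ⟨
    sumBelow p (λ y → if 0 <ᵇ y then pow γ y else 0#)          ≈⟨ sum-positive-rootOfUnity char2 isField p (ℕ.<-trans z<s 1<p) γᵖ≈1 γ≉1 ⟩
    1#                                                         ∎

  Hp-at-β : ∀ v → evalSet (p * p) (memHp v) β ≈ sumBelow (f / 2) (λ i → gaussPeriod (shifted f v i))
  Hp-at-β v = begin
    evalSet (p * p) (memHp v) β                                           ≈⟨ sum-enumerate (Hp-enumerate v) (pow β) ⟩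
    sumBelow (f / 2) (λ i → sumBelow e (λ t → pow β (Hp-elem v i t)))     ≈⟨ sum-cong (f / 2) (λ i _ → sum-cong e λ t _ → pow-* β p _) ⟩
    sumBelow (f / 2) (λ i → gaussPeriod (shifted f v i))                  ∎

  [p∸1]/2≡ef₂ : (p ∸ 1) / 2 ≡ e * f₂
  [p∸1]/2≡ef₂ = ≡.trans (≡.cong (_/ 2) (≡.trans p∸1≡ef (≡.cong (e *_) f≡2f₂))) (m*[2*n]/2≡m*n e f₂)

  f/2≡f₂ : f / 2 ≡ f₂
  f/2≡f₂ = ≡.trans (≡.cong (_/ 2) (≡.trans f≡2f₂ (ℕ.*-comm 2 f₂))) (m*n/n≡m f₂ 2)

  pf/2≡ef₂f+f₂ : p * f / 2 ≡ e * f₂ * f + f₂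
  pf/2≡ef₂f+f₂ = ≡.trans (≡.cong (_/ 2) (≡.trans (≡.cong (_* f) p≡1+ef) (≡.cong (λ u → (1 + e * u) * u) f≡2f₂)))
                         (≡.trans ([1+m*[2*n]]*[2*n]/2≡m*n*[2*n]+n e f₂) (≡.cong (λ u → e * f₂ * u + f₂) (≡.sym f≡2f₂)))
    where
    p≡1+ef : p ≡ 1 + e * f
    p≡1+ef = ≡.trans (≡.sym (ℕ.m+[n∸m]≡n (ℕ.<⇒≤ 1<p))) (≡.cong (1 +_) p∸1≡ef)

  module _ (K : ℕ) where

    α : Carrier
    α = pow γ (g ^ K % p)

    α-pow : ∀ y → pow α y ≈ pow γ ((g ^ K % p * y) % p)
    α-pow y = trans (sym (pow-* γ (g ^ K % p) y)) (pow-% p γᵖ≈1 _)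

    α-pow-p* : ∀ X → pow α (p * X) ≈ 1#
    α-pow-p* X = trans (α-pow (p * X)) (reflexive (≡.cong (pow γ) (≡.trans (≡.cong (_% p) (regroup (g ^ K % p) p X)) (m*n%n≡0 (g ^ K % p * X) p))))
      where
      regroup : ∀ x p X → x * (p * X) ≡ x * X * p
      regroup = solve-∀

    Hp-at-α : ∀ v → evalSet (p * p) (memHp v) α ≈ parity ((p ∸ 1) / 2)
    Hp-at-α v = begin
      evalSet (p * p) (memHp v) α                                         ≈⟨ sum-enumerate (Hp-enumerate v) (pow α) ⟩
      sumBelow (f / 2) (λ i → sumBelow e (λ t → pow α (Hp-elem v i t)))   ≈⟨ sum-cong (f / 2) (λ i _ → sum-cong e λ t _ → α-pow-p* _) ⟩
      sumBelow (f / 2) (λ _ → sumBelow e (λ _ → 1#))                      ≈⟨ sum-periodic e (λ _ → 1#) (λ _ → refl) (f / 2) ⟨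
      sumBelow (f / 2 * e) (λ _ → 1#)                                     ≈⟨ sum-ones≈parity char2 (f / 2 * e) ⟩
      parity (f / 2 * e)                                                  ≡⟨ ≡.cong parity f/2*e≡[p∸1]/2 ⟩
      parity ((p ∸ 1) / 2)                                                ∎
      where
      f/2*e≡[p∸1]/2 = ≡.trans (≡.cong (_* e) f/2≡f₂) (≡.trans (ℕ.*-comm f₂ e) (≡.sym [p∸1]/2≡ef₂))

    α-pow-Hp² : ∀ v i t → pow α (Hp²-elem v i t) ≈ G (K + shifted (p * f) v i + f * t)
    α-pow-Hp² v i t = begin
      pow α (g ^ J % (p * p))                          ≈⟨ α-pow _ ⟩
      pow γ ((g ^ K % p * (g ^ J % (p * p))) % p)      ≡⟨ ≡.cong (pow γ) (%-cong-* p (m%n%n≡m%n _ p) (%p²%p (g ^ J))) ⟩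
      pow γ ((g ^ K * g ^ J) % p)                      ≡⟨ ≡.cong (λ u → pow γ (u % p)) (ℕ.^-distribˡ-+-* g K J) ⟨
      G (K + J)                                        ≡⟨ ≡.cong G (≡.trans (≡.cong (λ u → K + (s + u * f * t)) p≡1+[p∸1]) (regroup K s (p ∸ 1) f t)) ⟩
      G (K + s + f * t + (p ∸ 1) * (f * t))            ≈⟨ G-periodic (K + s + f * t) (f * t) ⟩
      G (K + s + f * t)                                ∎
      where
      s = shifted (p * f) v i
      J = s + p * f * t
      p≡1+[p∸1] : p ≡ 1 + (p ∸ 1)
      p≡1+[p∸1] = ≡.sym (ℕ.m+[n∸m]≡n (ℕ.<⇒≤ 1<p))
      regroup : ∀ K s q f t → K + (s + (1 + q) * f * t) ≡ K + s + f * t + q * (f * t)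
      regroup = solve-∀

    Hp²-at-α : ∀ v → evalSet (p * p) (memHp2 v) α
                     ≈ parity ((p ∸ 1) / 2) +ᴿ sumBelow f₂ (λ i → gaussPeriod (i + (K + v %ℕ (p * f))))
    Hp²-at-α v = begin
      evalSet (p * p) (memHp2 v) α                                              ≈⟨ sum-enumerate (Hp²-enumerate v) (pow α) ⟩
      sumBelow (p * f / 2) (λ i → sumBelow e (λ t → pow α (Hp²-elem v i t)))    ≈⟨ sum-cong (p * f / 2) (λ i _ → sum-cong e λ t _ → α-pow-Hp² v i t) ⟩
      sumBelow (p * f / 2) (λ i → gaussPeriod (K + shifted (p * f) v i))        ≈⟨ sum-cong (p * f / 2) (λ i _ → gaussPeriod-% (shifted-pf-mod-f K v i)) ⟩
      sumBelow (p * f / 2) F                                                    ≡⟨ ≡.cong (λ n → sumBelow n F) pf/2≡ef₂f+f₂ ⟩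
      sumBelow (e * f₂ * f + f₂) F                                              ≈⟨ sum-++ (e * f₂ * f) f₂ F ⟩
      sumBelow (e * f₂ * f) F +ᴿ sumBelow f₂ (λ i → F (e * f₂ * f + i))         ≈⟨ +-cong (sum-periodic f F F-+f (e * f₂))
                                                                                           (sum-cong f₂ λ i _ → F-+f* i) ⟩
      sumBelow (e * f₂) (λ _ → sumBelow f F) +ᴿ sumBelow f₂ F                   ≈⟨ +-congʳ (sum-cong (e * f₂) λ _ _ → full-period-sum) ⟩
      sumBelow (e * f₂) (λ _ → 1#) +ᴿ sumBelow f₂ F                             ≈⟨ +-congʳ (sum-ones≈parity char2 (e * f₂)) ⟩
      parity (e * f₂) +ᴿ sumBelow f₂ F                                          ≡⟨ ≡.cong (λ n → parity n +ᴿ sumBelow f₂ F) [p∸1]/2≡ef₂ ⟨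
      parity ((p ∸ 1) / 2) +ᴿ sumBelow f₂ F                                     ∎
      where
      W = K + v %ℕ (p * f)
      F : ℕ → Carrier
      F i = gaussPeriod (i + W)

      F-+f : ∀ i → F (f + i) ≈ F i
      F-+f i = trans (reflexive (≡.cong gaussPeriod (regroup f i W))) (gaussPeriod-+f (i + W))
        where
        regroup : ∀ f i W → f + i + W ≡ i + W + f
        regroup = solve-∀

      F-+f* : ∀ i → F (e * f₂ * f + i) ≈ F i
      F-+f* i = trans (reflexive (≡.cong gaussPeriod (regroup (e * f₂) f i W))) (gaussPeriod-+f* (i + W) (e * f₂))
        where
        regroup : ∀ h f i W → h * f + i + W ≡ i + W + f * h
        regroup = solve-∀

      full-period-sum : sumBelow f F ≈ 1#
      full-period-sum = trans (sum-rotate f gaussPeriod (λ i → trans (reflexive (≡.cong gaussPeriod (ℕ.+-comm f i))) (gaussPeriod-+f i)) W)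
                              gaussPeriods-sum

    βᵃ≈α : ∀ {a} → a ≡ p * (g ^ K % p) → pow β a ≈ α
    βᵃ≈α a≡pgᴷ = trans (reflexive (≡.cong (pow β) a≡pgᴷ)) (pow-* β p (g ^ K % p))

    Hp-at-β-shifted : ∀ b k → K % f ≡ k modℤ f % f →
                      evalSet (p * p) (memHp (b Data.Integer.+ k)) β ≈ sumBelow f₂ (λ i → gaussPeriod (i + (K + b %ℕ (p * f))))
    Hp-at-β-shifted b k K≡k = begin
      evalSet (p * p) (memHp (b Data.Integer.+ k)) β                           ≈⟨ Hp-at-β (b Data.Integer.+ k) ⟩
      sumBelow (f / 2) (λ i → gaussPeriod (shifted f (b Data.Integer.+ k) i))  ≈⟨ sum-cong (f / 2) (λ i _ →
                                                                                    gaussPeriod-% (shifted-sum-mod-f b k K≡k i)) ⟩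
      sumBelow (f / 2) F                                                       ≡⟨ ≡.cong (λ n → sumBelow n F) f/2≡f₂ ⟩
      sumBelow f₂ F                                                            ∎
      where
      F : ℕ → Carrier
      F i = gaussPeriod (i + (K + b %ℕ (p * f)))

    Hp-at-βᵃ : ∀ {a} → a ≡ p * (g ^ K % p) → ∀ b → evalSet (p * p) (memHp b) (pow β a) ≈ parity ((p ∸ 1) / 2)
    Hp-at-βᵃ a≡pgᴷ b = trans (evalSet-cong (p * p) (memHp b) (βᵃ≈α a≡pgᴷ)) (Hp-at-α b)

    Hp²-at-βᵃ : ∀ {a k} → a ≡ p * (g ^ K % p) → K % f ≡ k modℤ f % f → ∀ b →
                evalSet (p * p) (memHp2 b) (pow β a)
                  ≈ parity ((p ∸ 1) / 2) +ᴿ evalSet (p * p) (memHp (b Data.Integer.+ k)) β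
    Hp²-at-βᵃ {a} {k} a≡pgᴷ K≡k b = begin
      evalSet (p * p) (memHp2 b) (pow β a)                                           ≈⟨ evalSet-cong (p * p) (memHp2 b) (βᵃ≈α a≡pgᴷ) ⟩
      evalSet (p * p) (memHp2 b) α                                                   ≈⟨ Hp²-at-α b ⟩
      parity ((p ∸ 1) / 2) +ᴿ sumBelow f₂ (λ i → gaussPeriod (i + (K + b %ℕ (p * f)))) ≈⟨ +-congˡ (Hp-at-β-shifted b k K≡k) ⟨
      parity ((p ∸ 1) / 2) +ᴿ evalSet (p * p) (memHp (b Data.Integer.+ k)) β          ∎

lemma3 : {c ℓ : Level} (R : CommutativeRing c ℓ) →
  Eval.IsField R → Eval.Char2 R →
  (p e f r g : ℕ) → Prime p → 3 ≤ p →
  p ∸ 1 ≡ e * f → f ≡ 2 ^ r → 1 ≤ r →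
  IsPrimitiveRoot (p * p) (p * (p ∸ 1)) g →
  (β : CommutativeRing.Carrier R) → Eval.IsPrimitiveRootOfUnity R (p * p) β →
  (k : ℤ) (a : ℕ) → a < p * p → T (Cyclotomy.memPDp p g e f (k Defs.modℤ f) a) →
  (b : ℤ) →
  let open CommutativeRing R using (_≈_) renaming (_+_ to _+ᴿ_)
      open Eval R
      open Cyclotomy p g e f
  in (evalSet (p * p) (memHp b) (pow β a) ≈ parity ((p ∸ 1) / 2))
   × (evalSet (p * p) (memHp2 b) (pow β a)
        ≈ parity ((p ∸ 1) / 2) +ᴿ evalSet (p * p) (memHp (b Data.Integer.+ k)) β)
lemma3 R isField char2 p e f r g _ 3≤p p∸1≡ef f≡2ʳ 1≤r prim β β-primitive k a a<p² a∈pDₖ b =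
  let K , K≡k , a≡pgᴷ = memPDp-decode (k modℤ f) a<p² (Equivalence.to T-≡ a∈pDₖ)
  in  Hp-at-βᵃ K a≡pgᴷ b , Hp²-at-βᵃ K a≡pgᴷ K≡k b
  where
  instance
    f≢0 : NonZero f
    f≢0 = ≡.subst NonZero (≡.sym f≡2ʳ) (ℕ.m^n≢0 2 r)
  f≡2*2ʳ⁻¹ : f ≡ 2 * 2 ^ (r ∸ 1)
  f≡2*2ʳ⁻¹ = ≡.trans f≡2ʳ (≡.cong (2 ^_) (≡.sym (ℕ.m+[n∸m]≡n 1≤r)))
  open CyclotomicEvaluation R isField char2 p e f g (ℕ.<-trans (ℕ.n<1+n 1) 3≤p) p∸1≡ef
                            (2 ^ (r ∸ 1)) f≡2*2ʳ⁻¹ prim β β-primitive
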